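{- Let $q\equiv-1\pmod3$. Then for every $\rho\in\mathbb{F}_q^*$, the line $\mathcal{L}_\rho$ through $(\rho,0,0,1)$ and $(0,0,1,0)$ lies in the $G_q$-orbit of $\mathcal{L}_1$; i.e. all lines $\mathcal{L}_\rho$ belong to the same $G_q$-orbit.
   Context: Twisted cubic $\mathscr{C}=\{(t^3,t^2,t,1):t\in\mathbb{F}_q\}\cup\{(1,0,0,0)\}$ in $\mathrm{PG}(3,q)$. $G_q$ is the group of projectivities fixing $\mathscr{C}$, given (up to scalar, acting on row vectors $x\mapsto xM$) by the matrices $M(a,b,c,d)$ with rows $(a^3,a^2c,ac^2,c^3)$, $(3a^2b,a^2d+2abc,bc^2+2acd,3c^2d)$, $(3ab^2,b^2c+2abd,ad^2+2bcd,3cd^2)$, $(b^3,b^2d,bd^2,d^3)$, $a,b,c,d\in\mathbb{F}_q$, $ad-bc\ne0$. -}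

module Defs where

open import Level using (0ℓ)
open import Data.Nat using (ℕ)
open import Data.Fin using (Fin; zero; suc)
open import Data.Product using (Σ; ∃; _×_; _,_)
open import Relation.Binary.PropositionalEquality using (_≡_; _≢_)
open import Algebra.Structures using (IsCommutativeRing)
open import Function.Bundles using (_↔_; _⇔_)

record FiniteField (q : ℕ) : Set₁ where
  infixl 6 _+_
  infixl 7 _*_
  field
    F   : Set
    _+_ : F → F → F
    _*_ : F → F → F
    -_  : F → F
    0#  : F
    1#  : F
    isCommutativeRing : IsCommutativeRing _≡_ _+_ _*_ -_ 0# 1#
    0≢1  : 0# ≢ 1#
    inv  : ∀ x → x ≢ 0# → Σ F (λ y → x * y ≡ 1#)
    enum : F ↔ Fin q

module Geometry {q : ℕ} (𝔽 : FiniteField q) where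
  open FiniteField 𝔽

  -- vectors of F_q^4 (homogeneous coordinates of PG(3,q))
  V : Set
  V = Fin 4 → F

  3# : F
  3# = 1# + 1# + 1#

  vec : F → F → F → F → V
  vec x0 x1 x2 x3 zero = x0
  vec x0 x1 x2 x3 (suc zero) = x1
  vec x0 x1 x2 x3 (suc (suc zero)) = x2
  vec x0 x1 x2 x3 (suc (suc (suc zero))) = x3

  -- 4x4 matrices as functions (row index, column index)
  Mat : Set
  Mat = Fin 4 → Fin 4 → F

  M : F → F → F → F → Mat
  M a b c d zero = vec (a * a * a) (a * a * c) (a * c * c) (c * c * c)
  M a b c d (suc zero) =
    vec (3# * a * a * b) (a * a * d + (1# + 1#) * a * b * c)
        (b * c * c + (1# + 1#) * a * c * d) (3# * c * c * d)
  M a b c d (suc (suc zero)) =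
    vec (3# * a * b * b) (b * b * c + (1# + 1#) * a * b * d)
        (a * d * d + (1# + 1#) * b * c * d) (3# * c * d * d)
  M a b c d (suc (suc (suc zero))) = vec (b * b * b) (b * b * d) (b * d * d) (d * d * d)

  _·_ : V → Mat → V
  (x · m) j = x zero * m zero j + x (suc zero) * m (suc zero) j
            + x (suc (suc zero)) * m (suc (suc zero)) j
            + x (suc (suc (suc zero))) * m (suc (suc (suc zero))) j

  OnLine : V → V → V → Set
  OnLine u v x = ∃ λ (λ' : F) → ∃ λ (μ : F) → ∀ i → x i ≡ λ' * u i + μ * v i

  OnImage : Mat → V → V → V → Set
  OnImage m u v y = ∃ λ x → OnLine u v x × (∀ i → y i ≡ (x · m) i)

  Pρ : F → V
  Pρ ρ = vec ρ 0# 0# 1#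

  Q : V
  Q = vec 0# 0# 1# 0#

  InOrbitOfL1 : F → Set
  InOrbitOfL1 ρ =
    ∃ λ a → ∃ λ b → ∃ λ c → ∃ λ d →
      (a * d + - (b * c) ≢ 0#) ×
      (∀ y → OnImage (M a b c d) (Pρ 1#) Q y ⇔ OnLine (Pρ ρ) Q y)

-- The projectivity M(a,0,0,1) = diag(a³, a², a, 1) fixes (0,0,1,0) up to the scalar a
-- and sends (1,0,0,1) to (a³,0,0,1), so it maps L₁ onto L_{a³}. It remains to see
-- that every ρ ≠ 0 is a cube: with q = 3k + 2, Fermat's ρ^(q-1) = 1 gives
-- (ρ^(2k+1))³ = ρ^(2(q-1)+1) = ρ.
module Submission where

open import Defs
open import Data.Nat using (ℕ; _%_)
open import Relation.Binary.PropositionalEquality using (_≡_; _≢_)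

open import Level using (0ℓ)
import Data.Nat as ℕ
open import Data.Nat.DivMod using (_/_; m≡m%n+[m/n]*n)
open import Data.Nat.Tactic.RingSolver using (solve-∀)
open import Data.Fin using (Fin; zero; suc; punchIn)
open import Data.Fin.Properties using (punchInᵢ≢i)
open import Data.Fin.Permutation using (Permutation)
open import Data.Vec.Functional using (replicate; removeAt)
open import Data.Product using (∃; _×_; _,_; proj₁; proj₂)
open import Data.Empty using (⊥-elim)
open import Function.Bundles using (_↔_; _⇔_; mk↔ₛ′; Inverse; mk⇔)
open import Function.Construct.Composition using (_↔-∘_)
open import Function.Construct.Symmetry using (↔-sym)
open import Relation.Binary.Definitions using (DecidableEquality)
open import Relation.Binary.PropositionalEquality
  using (refl; sym; trans; cong; cong₂; module ≡-Reasoning)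
open import Relation.Nullary using (yes; no)
open import Algebra.Bundles using (CommutativeRing)

module FiniteFieldTheory {q : ℕ} (𝔽 : FiniteField q) where
  open FiniteField 𝔽

  commutativeRing : CommutativeRing 0ℓ 0ℓ
  commutativeRing = record { isCommutativeRing = isCommutativeRing }

  open CommutativeRing commutativeRing
    using (semiring; *-commutativeMonoid; *-comm; *-assoc; *-identityˡ; *-identityʳ; zeroˡ; zeroʳ)
  open import Algebra.Properties.Semiring.Exp semiring using (_^_; ^-homo-*)
  open import Algebra.Properties.CommutativeMonoid.Sum *-commutativeMonoid
    renaming (sum to ∏)
    using (sum-cong-≗; sum-remove; sum-replicate; sum-permute; ∑-distrib-+)
  open Inverse enum using (to; from; strictlyInverseˡ; strictlyInverseʳ)
  open ≡-Reasoning

  infix 4 _≟_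
  _≟_ : DecidableEquality F
  x ≟ y with to x Data.Fin.≟ to y
  ... | yes tx≡ty = yes (begin
    x             ≡⟨ strictlyInverseʳ x ⟨
    from (to x)   ≡⟨ cong from tx≡ty ⟩
    from (to y)   ≡⟨ strictlyInverseʳ y ⟩
    y             ∎)
  ... | no tx≢ty = no (λ x≡y → tx≢ty (cong to x≡y))

  _⁻¹ : ∀ x → x ≢ 0# → F
  (x ⁻¹) x≢0 = proj₁ (inv x x≢0)

  *-inverseʳ : ∀ x (x≢0 : x ≢ 0#) → x * (x ⁻¹) x≢0 ≡ 1#
  *-inverseʳ x x≢0 = proj₂ (inv x x≢0)

  *-inverseˡ : ∀ x (x≢0 : x ≢ 0#) → (x ⁻¹) x≢0 * x ≡ 1#
  *-inverseˡ x x≢0 = trans (*-comm _ x) (*-inverseʳ x x≢0)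

  *-cancelˡ-⁻¹ : ∀ x (x≢0 : x ≢ 0#) y → (x ⁻¹) x≢0 * (x * y) ≡ y
  *-cancelˡ-⁻¹ x x≢0 y = begin
    (x ⁻¹) x≢0 * (x * y) ≡⟨ *-assoc _ x y ⟨
    (x ⁻¹) x≢0 * x * y   ≡⟨ cong (_* y) (*-inverseˡ x x≢0) ⟩
    1# * y               ≡⟨ *-identityˡ y ⟩
    y                    ∎

  *-cancelʳ-⁻¹ : ∀ x (x≢0 : x ≢ 0#) y → y * (x ⁻¹) x≢0 * x ≡ y
  *-cancelʳ-⁻¹ x x≢0 y = begin
    y * (x ⁻¹) x≢0 * x   ≡⟨ *-assoc y _ x ⟩
    y * ((x ⁻¹) x≢0 * x) ≡⟨ cong (y *_) (*-inverseˡ x x≢0) ⟩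
    y * 1#               ≡⟨ *-identityʳ y ⟩
    y                    ∎

  *-nonzero : ∀ {x y} → x ≢ 0# → y ≢ 0# → x * y ≢ 0#
  *-nonzero {x} {y} x≢0 y≢0 xy≡0 = y≢0 (begin
    y                    ≡⟨ *-cancelˡ-⁻¹ x x≢0 y ⟨
    (x ⁻¹) x≢0 * (x * y) ≡⟨ cong ((x ⁻¹) x≢0 *_) xy≡0 ⟩
    (x ⁻¹) x≢0 * 0#      ≡⟨ zeroʳ _ ⟩
    0#                   ∎)

  x*y≡y⇒x≡1 : ∀ {x y} → y ≢ 0# → x * y ≡ y → x ≡ 1#
  x*y≡y⇒x≡1 {x} {y} y≢0 xy≡y = begin
    x                    ≡⟨ *-identityʳ x ⟨
    x * 1#               ≡⟨ cong (x *_) (*-inverseʳ y y≢0) ⟨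
    x * (y * (y ⁻¹) y≢0) ≡⟨ *-assoc x y _ ⟨
    x * y * (y ⁻¹) y≢0   ≡⟨ cong (_* (y ⁻¹) y≢0) xy≡y ⟩
    y * (y ⁻¹) y≢0       ≡⟨ *-inverseʳ y y≢0 ⟩
    1#                   ∎

  ∏-nonzero : ∀ {m} (t : Fin m → F) → (∀ i → t i ≢ 0#) → ∏ t ≢ 0#
  ∏-nonzero {ℕ.zero}  t t≢0 1≡0 = 0≢1 (sym 1≡0)
  ∏-nonzero {ℕ.suc m} t t≢0 =
    *-nonzero (t≢0 zero) (∏-nonzero (λ i → t (suc i)) (λ i → t≢0 (suc i)))

  ∏-constant-except-one : ∀ {m} (t : Fin m → F) i x → t i ≡ 1# →
                          (∀ j → j ≢ i → t j ≡ x) → ∏ t ≡ x ^ (m ℕ.∸ 1)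
  ∏-constant-except-one {ℕ.suc m} t i x tᵢ≡1 tⱼ≡x = begin
    ∏ t                    ≡⟨ sum-remove t ⟩
    t i * ∏ (removeAt t i) ≡⟨ cong₂ _*_ tᵢ≡1 (sum-cong-≗ tⱼ≡x′) ⟩
    1# * ∏ (replicate m x) ≡⟨ *-identityˡ _ ⟩
    ∏ (replicate m x)      ≡⟨ sum-replicate m ⟩
    x ^ m                  ∎
    where
    tⱼ≡x′ : ∀ j → removeAt t i j ≡ x
    tⱼ≡x′ j = tⱼ≡x (punchIn i j) (punchInᵢ≢i i j)

  unitPart : F → F
  unitPart x with x ≟ 0#
  ... | yes _ = 1#
  ... | no  _ = x

  unitPart-nonzero : ∀ x → unitPart x ≢ 0#
  unitPart-nonzero x with x ≟ 0#
  ... | yes _   = λ 1≡0 → 0≢1 (sym 1≡0)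
  ... | no  x≢0 = x≢0

  module _ (ρ : F) (ρ≢0 : ρ ≢ 0#) where

    ρ*-↔ : F ↔ F
    ρ*-↔ = mk↔ₛ′ (ρ *_) ((ρ ⁻¹) ρ≢0 *_) ρ*ρ⁻¹*y≡y (*-cancelˡ-⁻¹ ρ ρ≢0)
      where
      ρ*ρ⁻¹*y≡y : ∀ y → ρ * ((ρ ⁻¹) ρ≢0 * y) ≡ y
      ρ*ρ⁻¹*y≡y y = begin
        ρ * ((ρ ⁻¹) ρ≢0 * y) ≡⟨ *-assoc ρ _ y ⟨
        ρ * (ρ ⁻¹) ρ≢0 * y   ≡⟨ cong (_* y) (*-inverseʳ ρ ρ≢0) ⟩
        1# * y               ≡⟨ *-identityˡ y ⟩
        y                    ∎

    multiplier : F → F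
    multiplier x with x ≟ 0#
    ... | yes _ = 1#
    ... | no  _ = ρ

    unitPart-* : ∀ x → unitPart (ρ * x) ≡ multiplier x * unitPart x
    unitPart-* x with x ≟ 0# | ρ * x ≟ 0#
    ... | yes _   | yes _    = sym (*-identityˡ 1#)
    ... | yes x≡0 | no ρx≢0  = ⊥-elim (ρx≢0 (trans (cong (ρ *_) x≡0) (zeroʳ ρ)))
    ... | no  x≢0 | yes ρx≡0 = ⊥-elim (*-nonzero ρ≢0 x≢0 ρx≡0)
    ... | no  _   | no  _    = refl

    ∏-multiplier : ∏ (λ i → multiplier (from i)) ≡ ρ ^ (q ℕ.∸ 1)
    ∏-multiplier = ∏-constant-except-one _ (to 0#) ρ at-zero elsewhere
      where
      at-zero : multiplier (from (to 0#)) ≡ 1#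
      at-zero rewrite strictlyInverseʳ 0# with 0# ≟ 0#
      ... | yes _   = refl
      ... | no  0≢0 = ⊥-elim (0≢0 refl)
      elsewhere : ∀ j → j ≢ to 0# → multiplier (from j) ≡ ρ
      elsewhere j j≢0 with from j ≟ 0#
      ... | yes j≡0 = ⊥-elim (j≢0 (trans (sym (strictlyInverseˡ j)) (cong to j≡0)))
      ... | no  _   = refl

    -- Multiplication by ρ permutes F, so ∏ unitPart is ρ^(q-1) times itself;
    -- unitPart sends 0 to 1 only to keep that product nonzero.
    fermat : ρ ^ (q ℕ.∸ 1) ≡ 1#
    fermat = x*y≡y⇒x≡1 (∏-nonzero _ (λ i → unitPart-nonzero (from i))) (sym (begin
      ∏ (λ i → unitPart (from i))
        ≡⟨ sum-permute _ π ⟩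
      ∏ (λ i → unitPart (from (to (ρ * from i))))
        ≡⟨ sum-cong-≗ (λ i → cong unitPart (strictlyInverseʳ (ρ * from i))) ⟩
      ∏ (λ i → unitPart (ρ * from i))
        ≡⟨ sum-cong-≗ (λ i → unitPart-* (from i)) ⟩
      ∏ (λ i → multiplier (from i) * unitPart (from i))
        ≡⟨ ∑-distrib-+ (λ i → multiplier (from i)) (λ i → unitPart (from i)) ⟩
      ∏ (λ i → multiplier (from i)) * ∏ (λ i → unitPart (from i))
        ≡⟨ cong (_* _) ∏-multiplier ⟩
      ρ ^ (q ℕ.∸ 1) * ∏ (λ i → unitPart (from i)) ∎))
      where
      π : Permutation q q
      π = enum ↔-∘ (ρ*-↔ ↔-∘ ↔-sym enum)

  nonzero-is-cube : q % 3 ≡ 2 → ∀ ρ → ρ ≢ 0# → ∃ λ c → c ≢ 0# × c * c * c ≡ ρ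
  nonzero-is-cube q%3≡2 ρ ρ≢0 = c , c≢0 , c³≡ρ
    where
    k = q / 3
    m = ℕ.suc (k ℕ.* 2)
    c = ρ ^ m

    q∸1≡3k+1 : q ℕ.∸ 1 ≡ ℕ.suc (k ℕ.* 3)
    q∸1≡3k+1 = cong (ℕ._∸ 1) (trans (m≡m%n+[m/n]*n q 3) (cong (ℕ._+ k ℕ.* 3) q%3≡2))

    3m≡2[q∸1]+1 : m ℕ.+ m ℕ.+ m ≡ (q ℕ.∸ 1) ℕ.+ (q ℕ.∸ 1) ℕ.+ 1
    3m≡2[q∸1]+1 rewrite q∸1≡3k+1 = arithmetic k
      where
      arithmetic : ∀ k → ℕ.suc (k ℕ.* 2) ℕ.+ ℕ.suc (k ℕ.* 2) ℕ.+ ℕ.suc (k ℕ.* 2)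
                       ≡ ℕ.suc (k ℕ.* 3) ℕ.+ ℕ.suc (k ℕ.* 3) ℕ.+ 1
      arithmetic = solve-∀

    c³≡ρ : c * c * c ≡ ρ
    c³≡ρ = begin
      c * c * c                         ≡⟨ cong (_* c) (^-homo-* ρ m m) ⟨
      ρ ^ (m ℕ.+ m) * c                 ≡⟨ ^-homo-* ρ (m ℕ.+ m) m ⟨
      ρ ^ (m ℕ.+ m ℕ.+ m)               ≡⟨ cong (ρ ^_) 3m≡2[q∸1]+1 ⟩
      ρ ^ (n ℕ.+ n ℕ.+ 1)               ≡⟨ ^-homo-* ρ (n ℕ.+ n) 1 ⟩
      ρ ^ (n ℕ.+ n) * (ρ * 1#)          ≡⟨ cong₂ _*_ (^-homo-* ρ n n) (*-identityʳ ρ) ⟩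
      ρ ^ n * ρ ^ n * ρ                 ≡⟨ cong (λ t → t * t * ρ) (fermat ρ ρ≢0) ⟩
      1# * 1# * ρ                       ≡⟨ cong (_* ρ) (*-identityˡ 1#) ⟩
      1# * ρ                            ≡⟨ *-identityˡ ρ ⟩
      ρ                                 ∎
      where n = q ℕ.∸ 1

    c≢0 : c ≢ 0#
    c≢0 c≡0 = ρ≢0 (begin
      ρ          ≡⟨ c³≡ρ ⟨
      c * c * c  ≡⟨ cong (_* c) (cong (_* c) c≡0) ⟩
      0# * c * c ≡⟨ cong (_* c) (zeroˡ c) ⟩
      0# * c     ≡⟨ zeroˡ c ⟩
      0#         ∎)

module ProjectiveLines {q : ℕ} (𝔽 : FiniteField q) where
  open FiniteField 𝔽
  open Geometry 𝔽
  open FiniteFieldTheory 𝔽 using (commutativeRing; _⁻¹; *-cancelʳ-⁻¹)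
  open CommutativeRing commutativeRing
    using (ring; commutativeSemiring; +-identityʳ; *-assoc; *-identityʳ; zeroˡ)
  open import Algebra.Properties.Ring ring using (-0#≈0#)
  open import Algebra.Solver.Ring.NaturalCoefficients.Default commutativeSemiring
  open ≡-Reasoning

  ·-cong : ∀ {x x′ : V} m → (∀ j → x j ≡ x′ j) → ∀ j → (x · m) j ≡ (x′ · m) j
  ·-cong m x≗x′ j =
    cong₂ _+_ (cong₂ _+_ (cong₂ _+_ (cong (_* _) (x≗x′ zero)) (cong (_* _) (x≗x′ (suc zero))))
                         (cong (_* _) (x≗x′ (suc (suc zero)))))
              (cong (_* _) (x≗x′ (suc (suc (suc zero)))))

  ·-linear : ∀ m λ′ μ (u v : V) j →
             ((λ i → λ′ * u i + μ * v i) · m) j ≡ λ′ * (u · m) j + μ * (v · m) j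
  ·-linear m λ′ μ u v j =
    solve 14
      (λ l n u₀ u₁ u₂ u₃ v₀ v₁ v₂ v₃ m₀ m₁ m₂ m₃ →
         (l :* u₀ :+ n :* v₀) :* m₀ :+ (l :* u₁ :+ n :* v₁) :* m₁
           :+ (l :* u₂ :+ n :* v₂) :* m₂ :+ (l :* u₃ :+ n :* v₃) :* m₃
         := l :* (u₀ :* m₀ :+ u₁ :* m₁ :+ u₂ :* m₂ :+ u₃ :* m₃)
              :+ n :* (v₀ :* m₀ :+ v₁ :* m₁ :+ v₂ :* m₂ :+ v₃ :* m₃))
      refl λ′ μ (u zero) (u (suc zero)) (u (suc (suc zero))) (u (suc (suc (suc zero))))
               (v zero) (v (suc zero)) (v (suc (suc zero))) (v (suc (suc (suc zero))))
               (m zero j) (m (suc zero) j) (m (suc (suc zero)) j) (m (suc (suc (suc zero))) j)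

  image-of-line : ∀ m u v u′ v′ c → c ≢ 0# →
                  (∀ j → (u · m) j ≡ u′ j) → (∀ j → (v · m) j ≡ c * v′ j) →
                  ∀ y → OnImage m u v y ⇔ OnLine u′ v′ y
  image-of-line m u v u′ v′ c c≢0 u↦u′ v↦cv′ y = mk⇔ forward backward
    where
    image : ∀ λ′ μ j → ((λ i → λ′ * u i + μ * v i) · m) j ≡ λ′ * u′ j + μ * c * v′ j
    image λ′ μ j = begin
      ((λ i → λ′ * u i + μ * v i) · m) j   ≡⟨ ·-linear m λ′ μ u v j ⟩
      λ′ * (u · m) j + μ * (v · m) j       ≡⟨ cong₂ (λ s t → λ′ * s + μ * t) (u↦u′ j) (v↦cv′ j) ⟩
      λ′ * u′ j + μ * (c * v′ j)           ≡⟨ cong (λ′ * u′ j +_) (*-assoc μ c (v′ j)) ⟨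
      λ′ * u′ j + μ * c * v′ j             ∎

    forward : OnImage m u v y → OnLine u′ v′ y
    forward (x , (λ′ , μ , x≗) , y≗) =
      λ′ , μ * c , λ j → trans (y≗ j) (trans (·-cong m x≗ j) (image λ′ μ j))

    backward : OnLine u′ v′ y → OnImage m u v y
    backward (λ′ , μ , y≗) = _ , (λ′ , μ′ , λ _ → refl) , λ j → begin
      y j                         ≡⟨ y≗ j ⟩
      λ′ * u′ j + μ * v′ j        ≡⟨ cong (λ t → λ′ * u′ j + t * v′ j) (*-cancelʳ-⁻¹ c c≢0 μ) ⟨
      λ′ * u′ j + μ′ * c * v′ j   ≡⟨ image λ′ μ′ j ⟨
      ((λ i → λ′ * u i + μ′ * v i) · m) j ∎
      where
      μ′ = μ * (c ⁻¹) c≢0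

  Pρ1·m≡row₀+row₃ : ∀ m j → (Pρ 1# · m) j ≡ m zero j + m (suc (suc (suc zero))) j
  Pρ1·m≡row₀+row₃ m j = solve 4 (λ m₀ m₁ m₂ m₃ →
      con 1 :* m₀ :+ con 0 :* m₁ :+ con 0 :* m₂ :+ con 1 :* m₃ := m₀ :+ m₃)
    refl (m zero j) (m (suc zero) j) (m (suc (suc zero)) j) (m (suc (suc (suc zero))) j)

  Q·m≡row₂ : ∀ m j → (Q · m) j ≡ m (suc (suc zero)) j
  Q·m≡row₂ m j = solve 4 (λ m₀ m₁ m₂ m₃ →
      con 0 :* m₀ :+ con 0 :* m₁ :+ con 1 :* m₂ :+ con 0 :* m₃ := m₂)
    refl (m zero j) (m (suc zero) j) (m (suc (suc zero)) j) (m (suc (suc (suc zero))) j)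

  Pρ1·diagonal : ∀ a j → (Pρ 1# · M a 0# 0# 1#) j ≡ Pρ (a * a * a) j
  Pρ1·diagonal a j = trans (Pρ1·m≡row₀+row₃ (M a 0# 0# 1#) j) (rows₀₊₃ j)
    where
    rows₀₊₃ : ∀ j → M a 0# 0# 1# zero j + M a 0# 0# 1# (suc (suc (suc zero))) j ≡ Pρ (a * a * a) j
    rows₀₊₃ zero                   = solve 1 (λ a → a :* a :* a :+ con 0 :* con 0 :* con 0 := a :* a :* a) refl a
    rows₀₊₃ (suc zero)             = solve 1 (λ a → a :* a :* con 0 :+ con 0 :* con 0 :* con 1 := con 0) refl a
    rows₀₊₃ (suc (suc zero))       = solve 1 (λ a → a :* con 0 :* con 0 :+ con 0 :* con 1 :* con 1 := con 0) refl a
    rows₀₊₃ (suc (suc (suc zero))) = solve 1 (λ a → con 0 :* con 0 :* con 0 :+ con 1 :* con 1 :* con 1 := con 1) refl a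

  Q·diagonal : ∀ a j → (Q · M a 0# 0# 1#) j ≡ a * Q j
  Q·diagonal a j = trans (Q·m≡row₂ (M a 0# 0# 1#) j) (row₂ j)
    where
    two three : ∀ {n} → Polynomial n
    two   = con 1 :+ con 1
    three = con 1 :+ con 1 :+ con 1
    row₂ : ∀ j → M a 0# 0# 1# (suc (suc zero)) j ≡ a * Q j
    row₂ zero                   = solve 1 (λ a → three :* a :* con 0 :* con 0 := a :* con 0) refl a
    row₂ (suc zero)             = solve 1 (λ a → con 0 :* con 0 :* con 0 :+ two :* a :* con 0 :* con 1 := a :* con 0) refl a
    row₂ (suc (suc zero))       = solve 1 (λ a → a :* con 1 :* con 1 :+ two :* con 0 :* con 0 :* con 1 := a :* con 1) refl a
    row₂ (suc (suc (suc zero))) = solve 1 (λ a → three :* con 0 :* con 1 :* con 1 := a :* con 0) refl a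

  cube-inOrbitOfL1 : ∀ a → a ≢ 0# → InOrbitOfL1 (a * a * a)
  cube-inOrbitOfL1 a a≢0 = a , 0# , 0# , 1# , det≢0 ,
    image-of-line (M a 0# 0# 1#) (Pρ 1#) Q (Pρ (a * a * a)) Q a a≢0 (Pρ1·diagonal a) (Q·diagonal a)
    where
    det≢0 : a * 1# + - (0# * 0#) ≢ 0#
    det≢0 det≡0 = a≢0 (begin
      a                      ≡⟨ *-identityʳ a ⟨
      a * 1#                 ≡⟨ +-identityʳ (a * 1#) ⟨
      a * 1# + 0#            ≡⟨ cong (a * 1# +_) (trans (cong -_ (zeroˡ 0#)) -0#≈0#) ⟨
      a * 1# + - (0# * 0#)   ≡⟨ det≡0 ⟩
      0#                     ∎)

lemma6p4 : (q : ℕ) → q % 3 ≡ 2 → (𝔽 : FiniteField q) →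
    (ρ : FiniteField.F 𝔽) → ρ ≢ FiniteField.0# 𝔽 →
    Geometry.InOrbitOfL1 𝔽 ρ
lemma6p4 q q%3≡2 𝔽 ρ ρ≢0 with FiniteFieldTheory.nonzero-is-cube 𝔽 q%3≡2 ρ ρ≢0
... | c , c≢0 , refl = ProjectiveLines.cube-inOrbitOfL1 𝔽 c c≢0
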